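{- (1) Weak rectangular layouts are vertex monotone and edge monotone. (2) Strong rectangular layouts are vertex monotone but not edge monotone. (3) Rectangular duals are neither vertex monotone nor edge monotone.
   Context: For a graph $G=(V,E)$: a weak rectangular layout is a set of axis-parallel rectangles with pairwise disjoint interiors in bijection with $V$ such that for every edge the two rectangles' boundaries share a segment of positive length; a strong rectangular layout additionally requires that this happens only for adjacent vertices. A rectangular dual is a partition of an axis-parallel rectangle into axis-parallel rectangles (no four meeting at a point) in bijection with $V$ such that two rectangles share a boundary segment of positive length iff the vertices are adjacent. All renderings are on the integer grid (integer corners), and the area is that of the smallest enclosing bounding box; for a rendering strategy (weak layouts, strong layouts, or rectangular duals), $A^*(G)$ denotes the minimum area of a rendering of $G$. For $V'\subset V$, $G_{V'}$ is the subgraph induced on $V\setminus V'$; for $E'\subset E$, $G_{E'}$ is the graph with edge set $E\setminus E'$ with isolated vertices removed. A subset $V'$ (resp. $E'$) is rendering preserving if $G_{V'}$ (resp. $G_{E'}$) admits a rendering. A strategy is vertex (resp. edge) monotone if for every graph $G$ admitting a rendering and every rendering-preserving vertex subset $V'$ (resp. edge subset $E'$), $A^*(G_{V'})\le A^*(G)$ (resp. $A^*(G_{E'})\le A^*(G)$). -}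

module Defs where

open import Data.Nat using (ℕ)
open import Data.Fin using (Fin)
open import Data.Integer using (ℤ; +_; _+_; _-_; _*_; _≤_; _<_)
open import Data.Product using (Σ; ∃; _×_)
open import Data.Sum using (_⊎_)
open import Data.Unit using (⊤)
open import Relation.Nullary using (¬_)
open import Relation.Binary.PropositionalEquality using (_≡_; _≢_)

record Graph : Set₁ where
  field
    n      : ℕ
    adj    : Fin n → Fin n → Set
    sym    : ∀ {u v} → adj u v → adj v u
    irrefl : ∀ {v} → ¬ adj v v
open Graph public

-- A graph given by a vertex subset and an edge relation on Fin n
-- (used for G itself and for G_{V'}, G_{E'}, keeping the original labels).
record SubG (n : ℕ) : Set₁ where
  constructor subG
  field
    Vs : Fin n → Set
    Es : Fin n → Fin n → Set
open SubG public

full : (G : Graph) → SubG (n G)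
full G = subG (λ _ → ⊤) (adj G)

delV : (G : Graph) → (Fin (n G) → Set) → SubG (n G)
delV G V' = subG (λ v → ¬ V' v)
                 (λ u v → adj G u v × ¬ V' u × ¬ V' v)

remE : (G : Graph) → (Fin (n G) → Fin (n G) → Set) → Fin (n G) → Fin (n G) → Set
remE G E' u v = adj G u v × ¬ (E' u v ⊎ E' v u)

delE : (G : Graph) → (Fin (n G) → Fin (n G) → Set) → SubG (n G)
delE G E' = subG (λ v → ∃ λ u → remE G E' v u) (remE G E')

record Rect : Set where
  constructor rect
  field
    x1 x2 y1 y2 : ℤ
open Rect public

NonDeg : Rect → Set
NonDeg r = (x1 r < x2 r) × (y1 r < y2 r)

DisjInt : Rect → Rect → Set
DisjInt r s = (x2 r ≤ x1 s) ⊎ (x2 s ≤ x1 r) ⊎ (y2 r ≤ y1 s) ⊎ (y2 s ≤ y1 r)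

VTouch : Rect → Rect → Set
VTouch r s = (x2 r ≡ x1 s) × (y1 r < y2 s) × (y1 s < y2 r)

HTouch : Rect → Rect → Set
HTouch r s = (y2 r ≡ y1 s) × (x1 r < x2 s) × (x1 s < x2 r)

Touch : Rect → Rect → Set
Touch r s = VTouch r s ⊎ VTouch s r ⊎ HTouch r s ⊎ HTouch s r

Inside : Rect → Rect → Set
Inside r s = (x1 s ≤ x1 r) × (x2 r ≤ x2 s) × (y1 s ≤ y1 r) × (y2 r ≤ y2 s)

ContainsPt : Rect → ℤ → ℤ → Set
ContainsPt r x y = (x1 r ≤ x) × (x ≤ x2 r) × (y1 r ≤ y) × (y ≤ y2 r)

-- r contains the unit grid cell [i,i+1] × [j,j+1]
ContainsCell : Rect → ℤ → ℤ → Set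
ContainsCell r i j = (x1 r ≤ i) × (i < x2 r) × (y1 r ≤ j) × (j < y2 r)

Layout : ℕ → Set
Layout n = Fin n → Rect

IsLayout : ∀ {n} → SubG n → Layout n → Set
IsLayout H L =
  (∀ v → Vs H v → NonDeg (L v)) ×
  (∀ u v → Vs H u → Vs H v → u ≢ v → DisjInt (L u) (L v))

WeakLayout : ∀ {n} → SubG n → Layout n → Set
WeakLayout H L =
  IsLayout H L × (∀ u v → Es H u v → Touch (L u) (L v))

StrongLayout : ∀ {n} → SubG n → Layout n → Set
StrongLayout H L =
  WeakLayout H L ×
  (∀ u v → Vs H u → Vs H v → u ≢ v → Touch (L u) (L v) → Es H u v)

NoFour : ∀ {n} → SubG n → Layout n → Set
NoFour {n} H L =
  ¬ (Σ ℤ λ x → Σ ℤ λ y → Σ (Fin n) λ a → Σ (Fin n) λ b → Σ (Fin n) λ c → Σ (Fin n) λ d →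
       (Vs H a × Vs H b × Vs H c × Vs H d) ×
       (a ≢ b × a ≢ c × a ≢ d × b ≢ c × b ≢ d × c ≢ d) ×
       (ContainsPt (L a) x y × ContainsPt (L b) x y ×
        ContainsPt (L c) x y × ContainsPt (L d) x y))

Partitions : ∀ {n} → SubG n → Layout n → Set
Partitions {n} H L =
  Σ Rect λ R → NonDeg R ×
    (∀ v → Vs H v → Inside (L v) R) ×
    (∀ i j → ContainsCell R i j → Σ (Fin n) λ v → Vs H v × ContainsCell (L v) i j)

RectDual : ∀ {n} → SubG n → Layout n → Set
RectDual H L = StrongLayout H L × Partitions H L × NoFour H L

data Strategy : Set where
  weak strong dual : Strategy

Renders : Strategy → ∀ {n} → SubG n → Layout n → Set
Renders weak   = WeakLayout
Renders strong = StrongLayout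
Renders dual   = RectDual

Admits : Strategy → ∀ {n} → SubG n → Set
Admits s {n} H = Σ (Layout n) λ L → Renders s H L

FitsIn : ∀ {n} → SubG n → Layout n → ℕ → Set
FitsIn H L a =
  Σ Rect λ B → (x1 B ≤ x2 B) × (y1 B ≤ y2 B) ×
    (∀ v → Vs H v → Inside (L v) B) ×
    ((x2 B - x1 B) * (y2 B - y1 B) ≤ + a)

-- A*(H) ≤ A*(K): every area achievable by a rendering of K is achievable by one of H
-- (equivalent to the inequality of minima, since areas are natural numbers).
AreaLE : Strategy → ∀ {n} → SubG n → SubG n → Set
AreaLE s {n} H K =
  ∀ (L : Layout n) → Renders s K L → ∀ (a : ℕ) → FitsIn K L a →
    Σ (Layout n) λ L' → Renders s H L' × FitsIn H L' a

VertexMonotone : Strategy → Set₁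
VertexMonotone s =
  ∀ (G : Graph) → Admits s (full G) →
  ∀ (V' : Fin (n G) → Set) → Admits s (delV G V') →
  AreaLE s (delV G V') (full G)

EdgeMonotone : Strategy → Set₁
EdgeMonotone s =
  ∀ (G : Graph) → Admits s (full G) →
  ∀ (E' : Fin (n G) → Fin (n G) → Set) → Admits s (delE G E') →
  AreaLE s (delE G E') (full G)

{-# OPTIONS --safe #-}
module Submission where

-- A rendering of G restricts to a rendering of a subgraph within the same bounding box:
-- for weak layouts any subgraph, for strong layouts any induced subgraph, such as G_{V'}.
-- This gives the positive statements.
--
-- Each negative statement is witnessed by a small graph G with a rendering of area A and a
-- reduced graph H that has a rendering, but none of area at most A. For the latter, a
-- rendering of area at most A is translated, and transposed if necessary, into a frame
-- [0, w] × [0, h] with w ≤ h and w h ≤ A. Its rectangles are then among the finitely many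
-- rectangles of the frame, so a search that places the vertices one by one, discarding after
-- each placement the candidates of the other vertices that became incompatible, finds it.
-- For every such frame the search fails.

open import Algebra.Bundles using (AbelianGroup)
open import Data.Bool using (Bool; true; T; not)
open import Data.Bool.Properties using (T-≡; T-not-≡)
open import Data.Bool.ListAction using (any; all)
open import Data.Empty using (⊥)
open import Data.Fin using (Fin; toℕ; fromℕ<; #_)
open import Data.Fin.Properties using (_≟_; toℕ<n; toℕ-fromℕ<)
import Data.Fin.Properties as Fin
open import Data.Integer as ℤ
  using (ℤ; +_; -[1+_]; +≤+; +<+; -_; _+_; _-_; _*_; _≤_; _<_; _⊔_; _⊓_; ∣_∣)
import Data.Integer.Properties as ℤ
open import Algebra.Properties.Group (AbelianGroup.group ℤ.+-0-abelianGroup)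
  using (//-rightDividesˡ; //-rightDividesʳ)
open import Data.List
  using (List; []; _∷_; length; map; filter; upTo; cartesianProduct; cartesianProductWith; allFin)
open import Data.List.Membership.Propositional using (_∈_; lose)
open import Data.List.Membership.Propositional.Properties
  using (∈-map⁺; ∈-filter⁺; ∈-cartesianProduct⁺; ∈-cartesianProductWith⁺; ∈-upTo⁺; ∈-allFin)
open import Data.List.Relation.Unary.All as All using (All; []; _∷_)
import Data.List.Relation.Unary.All.Properties as All
open import Data.List.Relation.Unary.Any as Any using (Any; here; there)
import Data.List.Relation.Unary.Any.Properties as Any
open import Data.Nat as ℕ using (ℕ; suc; z≤n; s≤s)
import Data.Nat.Properties as ℕ
open import Data.Product using (∃; _×_; _,_; proj₁; proj₂; uncurry)
import Data.Product.Properties as Product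
open import Data.Sum as Sum using (_⊎_; inj₁; inj₂; [_,_])
open import Data.Unit using (⊤; tt)
open import Data.Vec as Vec using (Vec; []; _∷_; tabulate; lookup)
import Data.Vec.Properties as Vec
open import Data.Vec.Relation.Unary.All as VecAll using ([]; _∷_)
import Data.Vec.Relation.Unary.All.Properties as VecAll
import Data.Vec.Relation.Unary.Any as VecAny
import Data.Vec.Relation.Unary.Any.Properties as VecAny
open import Function using (_∘_; id)
open import Function.Bundles using (Equivalence)
open import Relation.Nullary using (¬_; Dec; yes; no; ¬?)
open import Relation.Nullary.Decidable using (_×-dec_; _⊎-dec_; _→-dec_; ⌊_⌋; from-yes; fromWitness)
open import Relation.Unary using (Decidable)
open import Relation.Binary.PropositionalEquality
  using (_≡_; _≢_; refl; sym; trans; cong; cong₂; subst; subst₂)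

open import Defs hiding (sym)

record _⊑_ {n : ℕ} (H K : SubG n) : Set where
  field
    vertex⊆ : ∀ {v} → Vs H v → Vs K v
    edge⊆   : ∀ {u v} → Es H u v → Es K u v
open _⊑_

Induced : ∀ {n} → SubG n → SubG n → Set
Induced H K = ∀ {u v} → Vs H u → Vs H v → Es K u v → Es H u v

module _ {n} {H K : SubG n} (H⊑K : H ⊑ K) {L : Layout n} where

  isLayout-⊑ : IsLayout K L → IsLayout H L
  isLayout-⊑ (nonDeg , disjoint) =
    (λ v → nonDeg v ∘ vertex⊆ H⊑K) ,
    (λ u v hu hv → disjoint u v (vertex⊆ H⊑K hu) (vertex⊆ H⊑K hv))

  weakLayout-⊑ : WeakLayout K L → WeakLayout H L
  weakLayout-⊑ (layout , touches) = isLayout-⊑ layout , λ u v → touches u v ∘ edge⊆ H⊑K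

  strongLayout-⊑ : Induced H K → StrongLayout K L → StrongLayout H L
  strongLayout-⊑ induced (weakL , onlyEdges) =
    weakLayout-⊑ weakL ,
    λ u v hu hv u≢v → induced hu hv ∘ onlyEdges u v (vertex⊆ H⊑K hu) (vertex⊆ H⊑K hv) u≢v

  fitsIn-⊑ : ∀ {a} → FitsIn K L a → FitsIn H L a
  fitsIn-⊑ (B , x≤ , y≤ , inside , area) = B , x≤ , y≤ , (λ v → inside v ∘ vertex⊆ H⊑K) , area

areaLE-weak : ∀ {n} {H K : SubG n} → H ⊑ K → AreaLE weak H K
areaLE-weak H⊑K L weakL a fits = L , weakLayout-⊑ H⊑K weakL , fitsIn-⊑ H⊑K fits

areaLE-strong : ∀ {n} {H K : SubG n} → H ⊑ K → Induced H K → AreaLE strong H K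
areaLE-strong H⊑K induced L strongL a fits =
  L , strongLayout-⊑ H⊑K induced strongL , fitsIn-⊑ H⊑K fits

delV-⊑ : ∀ G V′ → delV G V′ ⊑ full G
delV-⊑ G V′ = record { vertex⊆ = λ _ → tt ; edge⊆ = proj₁ }

delV-induced : ∀ G V′ → Induced (delV G V′) (full G)
delV-induced G V′ hu hv uv = uv , hu , hv

delE-⊑ : ∀ G E′ → delE G E′ ⊑ full G
delE-⊑ G E′ = record { vertex⊆ = λ _ → tt ; edge⊆ = proj₁ }

weak-vertexMonotone : VertexMonotone weak
weak-vertexMonotone G _ V′ _ = areaLE-weak (delV-⊑ G V′)

weak-edgeMonotone : EdgeMonotone weak
weak-edgeMonotone G _ E′ _ = areaLE-weak (delE-⊑ G E′)

strong-vertexMonotone : VertexMonotone strong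
strong-vertexMonotone G _ V′ _ = areaLE-strong (delV-⊑ G V′) (delV-induced G V′)

nonDeg? : ∀ r → Dec (NonDeg r)
nonDeg? r = x1 r ℤ.<? x2 r ×-dec y1 r ℤ.<? y2 r

disjInt? : ∀ r s → Dec (DisjInt r s)
disjInt? r s = x2 r ℤ.≤? x1 s ⊎-dec x2 s ℤ.≤? x1 r ⊎-dec y2 r ℤ.≤? y1 s ⊎-dec y2 s ℤ.≤? y1 r

vTouch? : ∀ r s → Dec (VTouch r s)
vTouch? r s = x2 r ℤ.≟ x1 s ×-dec y1 r ℤ.<? y2 s ×-dec y1 s ℤ.<? y2 r

hTouch? : ∀ r s → Dec (HTouch r s)
hTouch? r s = y2 r ℤ.≟ y1 s ×-dec x1 r ℤ.<? x2 s ×-dec x1 s ℤ.<? x2 r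

touch? : ∀ r s → Dec (Touch r s)
touch? r s = vTouch? r s ⊎-dec vTouch? s r ⊎-dec hTouch? r s ⊎-dec hTouch? s r

inside? : ∀ r s → Dec (Inside r s)
inside? r s = x1 s ℤ.≤? x1 r ×-dec x2 r ℤ.≤? x2 s ×-dec y1 s ℤ.≤? y1 r ×-dec y2 r ℤ.≤? y2 s

containsCell? : ∀ r i j → Dec (ContainsCell r i j)
containsCell? r i j = x1 r ℤ.≤? i ×-dec i ℤ.<? x2 r ×-dec y1 r ℤ.≤? j ×-dec j ℤ.<? y2 r

-- Maps of the plane that preserve layouts

record Rigid (f : Rect → Rect) : Set where
  field
    nonDeg  : ∀ r → NonDeg r → NonDeg (f r)
    disjInt : ∀ r s → DisjInt r s → DisjInt (f r) (f s)
    touch   : ∀ r s → Touch r s → Touch (f r) (f s)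
    touch⁻  : ∀ r s → Touch (f r) (f s) → Touch r s

strongLayout-rigid : ∀ {n} {H : SubG n} {L : Layout n} {f} → Rigid f →
                     StrongLayout H L → StrongLayout H (f ∘ L)
strongLayout-rigid {L = L} rigid (((nonDeg , disjoint) , touches) , onlyEdges) =
  (((λ v → Rigid.nonDeg rigid (L v) ∘ nonDeg v) ,
    (λ u v hu hv → Rigid.disjInt rigid (L u) (L v) ∘ disjoint u v hu hv)) ,
   (λ u v → Rigid.touch rigid (L u) (L v) ∘ touches u v)) ,
  (λ u v hu hv u≢v → onlyEdges u v hu hv u≢v ∘ Rigid.touch⁻ rigid (L u) (L v))

translate : ℤ → ℤ → Rect → Rect
translate dx dy r = rect (x1 r + dx) (x2 r + dx) (y1 r + dy) (y2 r + dy)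

module _ (dx dy : ℤ) where

  translate-nonDeg : ∀ r → NonDeg r → NonDeg (translate dx dy r)
  translate-nonDeg _ (x< , y<) = ℤ.+-monoˡ-< dx x< , ℤ.+-monoˡ-< dy y<

  translate-disjInt : ∀ r s → DisjInt r s → DisjInt (translate dx dy r) (translate dx dy s)
  translate-disjInt _ _ = Sum.map (ℤ.+-monoˡ-≤ dx) (Sum.map (ℤ.+-monoˡ-≤ dx)
                            (Sum.map (ℤ.+-monoˡ-≤ dy) (ℤ.+-monoˡ-≤ dy)))

  translate-vTouch : ∀ r s → VTouch r s → VTouch (translate dx dy r) (translate dx dy s)
  translate-vTouch _ _ (x≡ , y< , y<′) = cong (_+ dx) x≡ , ℤ.+-monoˡ-< dy y< , ℤ.+-monoˡ-< dy y<′

  translate-hTouch : ∀ r s → HTouch r s → HTouch (translate dx dy r) (translate dx dy s)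
  translate-hTouch _ _ (y≡ , x< , x<′) = cong (_+ dy) y≡ , ℤ.+-monoˡ-< dx x< , ℤ.+-monoˡ-< dx x<′

  translate-touch : ∀ r s → Touch r s → Touch (translate dx dy r) (translate dx dy s)
  translate-touch r s (inj₁ t)               = inj₁ (translate-vTouch r s t)
  translate-touch r s (inj₂ (inj₁ t))        = inj₂ (inj₁ (translate-vTouch s r t))
  translate-touch r s (inj₂ (inj₂ (inj₁ t))) = inj₂ (inj₂ (inj₁ (translate-hTouch r s t)))
  translate-touch r s (inj₂ (inj₂ (inj₂ t))) = inj₂ (inj₂ (inj₂ (translate-hTouch s r t)))

  translate-inside : ∀ r s → Inside r s → Inside (translate dx dy r) (translate dx dy s)
  translate-inside _ _ (x≤ , x≤′ , y≤ , y≤′) =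
    ℤ.+-monoˡ-≤ dx x≤ , ℤ.+-monoˡ-≤ dx x≤′ , ℤ.+-monoˡ-≤ dy y≤ , ℤ.+-monoˡ-≤ dy y≤′

  translate-containsCell : ∀ r {i j} → ContainsCell r i j →
                           ContainsCell (translate dx dy r) (i + dx) (j + dy)
  translate-containsCell _ (x≤ , x< , y≤ , y<) =
    ℤ.+-monoˡ-≤ dx x≤ , ℤ.+-monoˡ-< dx x< , ℤ.+-monoˡ-≤ dy y≤ , ℤ.+-monoˡ-< dy y<

translate-inverse : ∀ dx dy r → translate (- dx) (- dy) (translate dx dy r) ≡ r
translate-inverse dx dy (rect a b c d)
  rewrite //-rightDividesʳ dx a | //-rightDividesʳ dx b
        | //-rightDividesʳ dy c | //-rightDividesʳ dy d = refl

translate-containsCell⁻ : ∀ dx dy r {i j} → ContainsCell (translate dx dy r) i j →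
                          ContainsCell r (i - dx) (j - dy)
translate-containsCell⁻ dx dy r cell =
  subst (λ r′ → ContainsCell r′ _ _) (translate-inverse dx dy r)
    (translate-containsCell (- dx) (- dy) (translate dx dy r) cell)

translate-rigid : ∀ dx dy → Rigid (translate dx dy)
translate-rigid dx dy = record
  { nonDeg  = translate-nonDeg dx dy
  ; disjInt = translate-disjInt dx dy
  ; touch   = translate-touch dx dy
  ; touch⁻  = λ r s t → subst₂ Touch (translate-inverse dx dy r) (translate-inverse dx dy s)
                          (translate-touch (- dx) (- dy) (translate dx dy r) (translate dx dy s) t)
  }

transpose : Rect → Rect
transpose r = rect (y1 r) (y2 r) (x1 r) (x2 r)

transpose-disjInt : ∀ r s → DisjInt r s → DisjInt (transpose r) (transpose s)
transpose-disjInt _ _ (inj₁ x≤)               = inj₂ (inj₂ (inj₁ x≤))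
transpose-disjInt _ _ (inj₂ (inj₁ x≤))        = inj₂ (inj₂ (inj₂ x≤))
transpose-disjInt _ _ (inj₂ (inj₂ (inj₁ y≤))) = inj₁ y≤
transpose-disjInt _ _ (inj₂ (inj₂ (inj₂ y≤))) = inj₂ (inj₁ y≤)

-- VTouch r s is by definition HTouch (transpose r) (transpose s), and vice versa.
transpose-touch : ∀ r s → Touch r s → Touch (transpose r) (transpose s)
transpose-touch _ _ (inj₁ t)               = inj₂ (inj₂ (inj₁ t))
transpose-touch _ _ (inj₂ (inj₁ t))        = inj₂ (inj₂ (inj₂ t))
transpose-touch _ _ (inj₂ (inj₂ (inj₁ t))) = inj₁ t
transpose-touch _ _ (inj₂ (inj₂ (inj₂ t))) = inj₂ (inj₁ t)

transpose-rigid : Rigid transpose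
transpose-rigid = record
  { nonDeg  = λ _ (x< , y<) → y< , x<
  ; disjInt = transpose-disjInt
  ; touch   = transpose-touch
  ; touch⁻  = λ r s → transpose-touch (transpose r) (transpose s)
  }

frame : ℕ → ℕ → Rect
frame w h = rect (+ 0) (+ w) (+ 0) (+ h)

width height : Rect → ℕ
width r = ∣ x2 r - x1 r ∣
height r = ∣ y2 r - y1 r ∣

+∣j-i∣ : ∀ {i j} → i ≤ j → + ∣ j - i ∣ ≡ j - i
+∣j-i∣ = ℤ.0≤i⇒+∣i∣≡i ∘ ℤ.i≤j⇒0≤j-i

∣-∣-mono : ∀ {a b c d} → a ≤ b → c ≤ a → b ≤ d → ∣ b - a ∣ ℕ.≤ ∣ d - c ∣
∣-∣-mono a≤b c≤a b≤d =
  ℤ.drop‿+≤+ (subst₂ _≤_ (sym (+∣j-i∣ a≤b)) (sym (+∣j-i∣ (ℤ.≤-trans c≤a (ℤ.≤-trans a≤b b≤d))))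
                (ℤ.+-mono-≤ b≤d (ℤ.neg-mono-≤ c≤a)))

translate-to-frame : ∀ r → x1 r ≤ x2 r → y1 r ≤ y2 r →
                     translate (- x1 r) (- y1 r) r ≡ frame (width r) (height r)
translate-to-frame (rect a b c d) a≤b c≤d
  rewrite ℤ.+-inverseʳ a | ℤ.+-inverseʳ c | +∣j-i∣ a≤b | +∣j-i∣ c≤d = refl

area-bound : ∀ B {a} → x1 B ≤ x2 B → y1 B ≤ y2 B →
             (x2 B - x1 B) * (y2 B - y1 B) ≤ + a → width B ℕ.* height B ℕ.≤ a
area-bound B x≤ y≤ area =
  ℤ.drop‿+≤+ (subst (_≤ _) (sym (trans (ℤ.pos-* (width B) (height B))
                                       (cong₂ _*_ (+∣j-i∣ x≤) (+∣j-i∣ y≤)))) area)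

nonDeg-inside : ∀ {r s} → NonDeg r → Inside r s → NonDeg s
nonDeg-inside (x< , y<) (x≤ , x≤′ , y≤ , y≤′) =
  ℤ.≤-<-trans x≤ (ℤ.<-≤-trans x< x≤′) , ℤ.≤-<-trans y≤ (ℤ.<-≤-trans y< y≤′)

frame-nonDeg : ∀ {w h} → NonDeg (frame w h) → 0 ℕ.< w × 0 ℕ.< h
frame-nonDeg (x< , y<) = ℤ.drop‿+<+ x< , ℤ.drop‿+<+ y<

frame-cell : ∀ {w h} (i : Fin w) (j : Fin h) → ContainsCell (frame w h) (+ toℕ i) (+ toℕ j)
frame-cell i j = +≤+ z≤n , +<+ (toℕ<n i) , +≤+ z≤n , +<+ (toℕ<n j)

frame-cells : ∀ {w h} {P : ℤ → ℤ → Set} → (∀ (i : Fin w) (j : Fin h) → P (+ toℕ i) (+ toℕ j)) →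
              ∀ i j → ContainsCell (frame w h) i j → P i j
frame-cells {P = P} f (+ i) (+ j) (_ , +<+ i<w , _ , +<+ j<h) =
  subst₂ P (cong +_ (toℕ-fromℕ< i<w)) (cong +_ (toℕ-fromℕ< j<h)) (f (fromℕ< i<w) (fromℕ< j<h))
frame-cells f (+ i) -[1+ j ] (_ , _ , () , _)
frame-cells f -[1+ i ] j (() , _)

module _ {n} (H : SubG n) where

  InFrame : Layout n → ℕ → ℕ → Set
  InFrame L w h = ∀ v → Vs H v → Inside (L v) (frame w h)

  Covered : Layout n → ℤ → ℤ → Set
  Covered L i j = ∃ λ v → Vs H v × ContainsCell (L v) i j

  CoversFrame : Layout n → ℕ → ℕ → Set
  CoversFrame L w h = ∀ (i : Fin w) (j : Fin h) → Covered L (+ toℕ i) (+ toℕ j)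

  inFrame-transpose : ∀ {L w h} → InFrame L w h → InFrame (transpose ∘ L) h w
  inFrame-transpose inFrame v hv = let x≤ , x≤′ , y≤ , y≤′ = inFrame v hv in y≤ , y≤′ , x≤ , x≤′

  coversFrame-transpose : ∀ {L w h} → CoversFrame L w h → CoversFrame (transpose ∘ L) h w
  coversFrame-transpose cover j i =
    let v , hv , (x≤ , x< , y≤ , y<) = cover i j in v , hv , (y≤ , y< , x≤ , x<)

  inFrame-translate : ∀ {L : Layout n} B → x1 B ≤ x2 B → y1 B ≤ y2 B →
                      (∀ v → Vs H v → Inside (L v) B) →
                      InFrame (translate (- x1 B) (- y1 B) ∘ L) (width B) (height B)
  inFrame-translate {L} B x≤ y≤ inside v hv =
    subst (Inside _) (translate-to-frame B x≤ y≤)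
      (translate-inside (- x1 B) (- y1 B) (L v) B (inside v hv))

  coversFrame-translate : ∀ {L : Layout n} R → x1 R ≤ x2 R → y1 R ≤ y2 R →
                          (∀ i j → ContainsCell R i j → Covered L i j) →
                          CoversFrame (translate (- x1 R) (- y1 R) ∘ L) (width R) (height R)
  coversFrame-translate {L} R x≤ y≤ cover i j
    with cover _ _ (translate-containsCell⁻ (- x1 R) (- y1 R) R
                      (subst (λ r → ContainsCell r (+ toℕ i) (+ toℕ j))
                             (sym (translate-to-frame R x≤ y≤)) (frame-cell i j)))
  ... | v , hv , cell =
    v , hv , subst₂ (ContainsCell _) (//-rightDividesˡ (- x1 R) _) (//-rightDividesˡ (- y1 R) _)
               (translate-containsCell (- x1 R) (- y1 R) (L v) cell)

  partitions-frame : ∀ {L w h} → 0 ℕ.< w → 0 ℕ.< h → InFrame L w h → CoversFrame L w h →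
                     Partitions H L
  partitions-frame {L} 0<w 0<h inFrame cover =
    frame _ _ , (+<+ 0<w , +<+ 0<h) , inFrame , frame-cells {P = Covered L} cover

  -- The cells at the lower left and upper right corners of R are covered by rectangles inside B.
  partition-inside : ∀ {L : Layout n} {R B} → NonDeg R →
                     (∀ i j → ContainsCell R i j → Covered L i j) →
                     (∀ v → Vs H v → Inside (L v) B) → Inside R B
  partition-inside {R = R} (x< , y<) cover inside
    with cover (x1 R) (y1 R) (ℤ.≤-refl , x< , ℤ.≤-refl , y<)
       | cover (ℤ.pred (x2 R)) (ℤ.pred (y2 R))
           (ℤ.i<j⇒i≤pred[j] x< , ℤ.i≤pred[j]⇒i<j ℤ.≤-refl ,
            ℤ.i<j⇒i≤pred[j] y< , ℤ.i≤pred[j]⇒i<j ℤ.≤-refl)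
  ... | u , hu , (ux≤ , _ , uy≤ , _) | v , hv , (_ , vx< , _ , vy<) =
    let Bx≤ , _ , By≤ , _ = inside u hu
        _ , x≤B , _ , y≤B = inside v hv
    in ℤ.≤-trans Bx≤ ux≤ , pred<⇒≤ (ℤ.<-≤-trans vx< x≤B) ,
       ℤ.≤-trans By≤ uy≤ , pred<⇒≤ (ℤ.<-≤-trans vy< y≤B)
    where
    pred<⇒≤ : ∀ {i j} → ℤ.pred i < j → i ≤ j
    pred<⇒≤ p = subst (_≤ _) (ℤ.suc-pred _) (ℤ.i<j⇒suc[i]≤j p)

  fitsIn-frame : ∀ {L : Layout n} w h {a} → InFrame L w h → w ℕ.* h ℕ.≤ a → FitsIn H L a
  fitsIn-frame w h inFrame wh≤a =
    frame w h , +≤+ z≤n , +≤+ z≤n , inFrame ,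
    subst (_≤ _) (trans (ℤ.pos-* w h) (sym (cong₂ _*_ (ℤ.+-identityʳ (+ w)) (ℤ.+-identityʳ (+ h)))))
      (+≤+ wh≤a)

infixl 7 _∩_
_∩_ : Rect → Rect → Rect
r ∩ s = rect (x1 r ⊔ x1 s) (x2 r ⊓ x2 s) (y1 r ⊔ y1 s) (y2 r ⊓ y2 s)

Nonempty : Rect → Set
Nonempty r = x1 r ≤ x2 r × y1 r ≤ y2 r

nonempty? : ∀ r → Dec (Nonempty r)
nonempty? r = x1 r ℤ.≤? x2 r ×-dec y1 r ℤ.≤? y2 r

containsPt-∩ : ∀ {r s x y} → ContainsPt r x y → ContainsPt s x y → ContainsPt (r ∩ s) x y
containsPt-∩ (x≤ , x≤′ , y≤ , y≤′) (x≤″ , x≤‴ , y≤″ , y≤‴) =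
  ℤ.⊔-lub x≤ x≤″ , ℤ.⊓-glb x≤′ x≤‴ , ℤ.⊔-lub y≤ y≤″ , ℤ.⊓-glb y≤′ y≤‴

containsPt-nonempty : ∀ {r x y} → ContainsPt r x y → Nonempty r
containsPt-nonempty (x≤ , x≤′ , y≤ , y≤′) = ℤ.≤-trans x≤ x≤′ , ℤ.≤-trans y≤ y≤′

Distinct₄ : ∀ {n} → Fin n → Fin n → Fin n → Fin n → Set
Distinct₄ a b c d = a ≢ b × a ≢ c × a ≢ d × b ≢ c × b ≢ d × c ≢ d

distinct₄? : ∀ {n} (a b c d : Fin n) → Dec (Distinct₄ a b c d)
distinct₄? a b c d = ¬? (a ≟ b) ×-dec ¬? (a ≟ c) ×-dec ¬? (a ≟ d) ×-dec
                     ¬? (b ≟ c) ×-dec ¬? (b ≟ d) ×-dec ¬? (c ≟ d)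

noFour-∩ : ∀ {n} (H : SubG n) {L : Layout n} →
           (∀ a b c d → Distinct₄ a b c d → ¬ Nonempty (L a ∩ L b ∩ L c ∩ L d)) → NoFour H L
noFour-∩ _ apart (_ , _ , a , b , c , d , _ , distinct , pa , pb , pc , pd) =
  apart a b c d distinct
    (containsPt-nonempty (containsPt-∩ (containsPt-∩ (containsPt-∩ pa pb) pc) pd))

module Decide {n} (H : SubG n) (vs? : Decidable (Vs H)) (es? : ∀ u v → Dec (Es H u v))
              (L : Layout n) where

  isLayout? : Dec (IsLayout H L)
  isLayout? =
    Fin.all? (λ v → vs? v →-dec nonDeg? (L v)) ×-dec
    Fin.all? (λ u → Fin.all? λ v →
      vs? u →-dec vs? v →-dec ¬? (u ≟ v) →-dec disjInt? (L u) (L v))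

  strongLayout? : Dec (StrongLayout H L)
  strongLayout? =
    (isLayout? ×-dec Fin.all? λ u → Fin.all? λ v → es? u v →-dec touch? (L u) (L v)) ×-dec
    Fin.all? (λ u → Fin.all? λ v →
      vs? u →-dec vs? v →-dec ¬? (u ≟ v) →-dec touch? (L u) (L v) →-dec es? u v)

  inFrame? : ∀ w h → Dec (InFrame H L w h)
  inFrame? w h = Fin.all? λ v → vs? v →-dec inside? (L v) (frame w h)

  DualOfFrame : ℕ → ℕ → Set
  DualOfFrame w h =
    StrongLayout H L × (0 ℕ.< w × 0 ℕ.< h) × InFrame H L w h × CoversFrame H L w h ×
    (∀ a b c d → Distinct₄ a b c d → ¬ Nonempty (L a ∩ L b ∩ L c ∩ L d))

  dualOfFrame? : ∀ w h → Dec (DualOfFrame w h)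
  dualOfFrame? w h =
    strongLayout? ×-dec (0 ℕ.<? w ×-dec 0 ℕ.<? h) ×-dec inFrame? w h ×-dec
    Fin.all? (λ i → Fin.all? λ j → Fin.any? λ v →
      vs? v ×-dec containsCell? (L v) (+ toℕ i) (+ toℕ j)) ×-dec
    Fin.all? λ a → Fin.all? λ b → Fin.all? λ c → Fin.all? λ d →
      distinct₄? a b c d →-dec ¬? (nonempty? (L a ∩ L b ∩ L c ∩ L d))

  rectDual : ∀ {w h} → DualOfFrame w h → RectDual H L
  rectDual (strongL , (0<w , 0<h) , inFrame , cover , apart) =
    strongL , partitions-frame H 0<w 0<h inFrame cover , noFour-∩ H apart

-- Exhaustive search for strong layouts inside a frame

intervals : ℕ → List (ℕ × ℕ)
intervals w = filter (uncurry ℕ._<?_) (cartesianProduct (upTo (suc w)) (upTo (suc w)))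

intervals-complete : ∀ {a b w} → a ℕ.< b → b ℕ.≤ w → (a , b) ∈ intervals w
intervals-complete a<b b≤w =
  ∈-filter⁺ (uncurry ℕ._<?_)
    (∈-cartesianProduct⁺ (∈-upTo⁺ (s≤s (ℕ.≤-trans (ℕ.<⇒≤ a<b) b≤w))) (∈-upTo⁺ (s≤s b≤w))) a<b

frameRects : ℕ → ℕ → List Rect
frameRects w h =
  cartesianProductWith (λ (a , b) (c , d) → rect (+ a) (+ b) (+ c) (+ d))
    (intervals w) (intervals h)

frameRects-complete : ∀ {w h} r → NonDeg r → Inside r (frame w h) → r ∈ frameRects w h
frameRects-complete (rect (+ a) (+ b) (+ c) (+ d)) (+<+ a<b , +<+ c<d) (_ , +≤+ b≤w , _ , +≤+ d≤h) =
  ∈-cartesianProductWith⁺ _ (intervals-complete a<b b≤w) (intervals-complete c<d d≤h)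
frameRects-complete (rect -[1+ _ ] _ _ _) _ (() , _)
frameRects-complete (rect (+ _) -[1+ _ ] _ _) (() , _) _
frameRects-complete (rect (+ _) (+ _) -[1+ _ ] _) _ (_ , _ , () , _)
frameRects-complete (rect (+ _) (+ _) (+ _) -[1+ _ ]) (_ , ()) _

module Search {n} (H : SubG n) (vs? : Decidable (Vs H)) (es? : ∀ u v → Dec (Es H u v)) where

  vertices : List (Fin n)
  vertices = filter vs? (allFin n)

  data Link : Set where
    same adjacent apart : Link

  link : Fin n → Fin n → Link
  link u v with u ≟ v | es? u v
  ... | yes _ | _     = same
  ... | no _  | yes _ = adjacent
  ... | no _  | no _  = apart

  -- Whether c may be the rectangle of u once r is that of v, for ℓ the link of u and v.
  -- `same` never occurs in the search, but spares proving the vertex list duplicate-free.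
  Compatible : Link → Rect → Rect → Set
  Compatible same     c r = ⊤
  Compatible adjacent c r = DisjInt c r × Touch c r
  Compatible apart    c r = DisjInt c r × ¬ Touch c r

  compatible? : ∀ ℓ c r → Dec (Compatible ℓ c r)
  compatible? same     c r = yes tt
  compatible? adjacent c r = disjInt? c r ×-dec touch? c r
  compatible? apart    c r = disjInt? c r ×-dec ¬? (touch? c r)

  Placement : Set
  Placement = List (Fin n × Rect)

  -- The vertices still to be placed, each with its remaining candidate rectangles.
  Domains : ℕ → Set
  Domains = Vec (Fin n × List Rect)

  LinkTable : Set
  LinkTable = Vec (Vec Link n) n

  linkTable : LinkTable
  linkTable = tabulate λ u → tabulate (link u)

  -- Agda's evaluator does not memoise calls of `link`, but evaluates a table received as an
  -- argument only once; the search consults the links constantly.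
  module _ (table : LinkTable) where

    restrictTo : Link → Rect → List Rect → List Rect
    restrictTo ℓ r = filter (λ c → compatible? ℓ c r)

    restrictEntry : Fin n × Rect → Fin n × List Rect → Fin n × List Rect
    restrictEntry (v , r) (u , cs) = u , restrictTo (lookup (lookup table u) v) r cs

    restrict : ∀ {k} → Fin n × Rect → Domains k → Domains k
    restrict p = Vec.map (restrictEntry p)

    completable : ∀ {k} → (Placement → Bool) → Placement → Domains k → Bool
    completable leaf ps []              = leaf ps
    completable leaf ps ((v , rs) ∷ ds) =
      any (λ r → completable leaf ((v , r) ∷ ps) (restrict (v , r) ds)) rs

  initialDomains : ∀ w h (vs : List (Fin n)) → Domains (length vs)
  initialDomains w h []       = []
  initialDomains w h (v ∷ vs) = (v , frameRects w h) ∷ initialDomains w h vs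

  search : ℕ → ℕ → (Placement → Bool) → Bool
  search w h leaf = completable linkTable leaf [] (initialDomains w h vertices)

  placement : Layout n → List (Fin n) → Placement
  placement L = map λ v → v , L v

  module Completeness {L : Layout n} (strongL : StrongLayout H L)
                      {w h : ℕ} (inFrame : InFrame H L w h) (leaf : Placement → Bool)
                      (leaf-complete : ∀ done → (∀ v → Vs H v → v ∈ done) →
                                       T (leaf (placement L done)))
                      where

    private
      nonDeg    = proj₁ (proj₁ (proj₁ strongL))
      disjoint  = proj₂ (proj₁ (proj₁ strongL))
      touches   = proj₂ (proj₁ strongL)
      onlyEdges = proj₂ strongL

    link-compatible : ∀ {u v} → Vs H u → Vs H v → Compatible (link u v) (L u) (L v)
    link-compatible {u} {v} hu hv with u ≟ v | es? u v
    ... | yes _  | _      = tt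
    ... | no u≢v | yes uv = disjoint u v hu hv u≢v , touches u v uv
    ... | no u≢v | no ¬uv = disjoint u v hu hv u≢v , ¬uv ∘ onlyEdges u v hu hv u≢v

    linkTable-link : ∀ u v → lookup (lookup linkTable u) v ≡ link u v
    linkTable-link u v =
      trans (cong (λ row → lookup row v) (Vec.lookup∘tabulate _ u)) (Vec.lookup∘tabulate _ v)

    Tracked : Fin n × List Rect → Set
    Tracked (u , cs) = Vs H u × L u ∈ cs

    Pending : Fin n → ∀ {k} → Domains k → Set
    Pending v = VecAny.Any ((v ≡_) ∘ proj₁)

    restrict-tracked : ∀ {k v} → Vs H v → (ds : Domains k) →
                       VecAll.All Tracked ds → VecAll.All Tracked (restrict linkTable (v , L v) ds)
    restrict-tracked {v = v} hv ds tracked = VecAll.map⁺ (VecAll.map keep tracked)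
      where
      keep : ∀ {e} → Tracked e → Tracked (restrictEntry linkTable (v , L v) e)
      keep {u , cs} (hu , Lu∈cs) =
        hu , ∈-filter⁺ (λ c → compatible? _ c (L v)) Lu∈cs
               (subst (λ ℓ → Compatible ℓ (L u) (L v)) (sym (linkTable-link u v))
                      (link-compatible hu hv))

    completable-complete : ∀ {k} done (ds : Domains k) → VecAll.All Tracked ds →
                           (∀ v → Vs H v → v ∈ done ⊎ Pending v ds) →
                           T (completable linkTable leaf (placement L done) ds)
    completable-complete done [] _ placed =
      leaf-complete done λ v hv → [ id , (λ ()) ] (placed v hv)
    completable-complete done ((v , rs) ∷ ds) ((hv , Lv∈rs) ∷ tracked) placed =
      Any.any⁺ _ (lose Lv∈rs (completable-complete (v ∷ done) (restrict linkTable (v , L v) ds)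
                                (restrict-tracked hv ds tracked) placed′))
      where
      placed′ : ∀ u → Vs H u → u ∈ v ∷ done ⊎ Pending u (restrict linkTable (v , L v) ds)
      placed′ u hu with placed u hu
      ... | inj₁ u∈done              = inj₁ (there u∈done)
      ... | inj₂ (VecAny.here refl)  = inj₁ (here refl)
      ... | inj₂ (VecAny.there u∈ds) = inj₂ (VecAny.map⁺ u∈ds)

    initial-tracked : ∀ vs → All (Vs H) vs → VecAll.All Tracked (initialDomains w h vs)
    initial-tracked []       []         = []
    initial-tracked (v ∷ vs) (hv ∷ hvs) =
      (hv , frameRects-complete (L v) (nonDeg v hv) (inFrame v hv)) ∷ initial-tracked vs hvs

    initial-pending : ∀ {v} vs → v ∈ vs → Pending v (initialDomains w h vs)
    initial-pending (u ∷ vs) (here refl)  = VecAny.here refl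
    initial-pending (u ∷ vs) (there v∈vs) = VecAny.there (initial-pending vs v∈vs)

    search-complete : T (search w h leaf)
    search-complete =
      completable-complete [] (initialDomains w h vertices)
        (initial-tracked vertices (All.all-filter vs? (allFin n)))
        (λ v hv → inj₂ (initial-pending vertices (∈-filter⁺ vs? (∈-allFin v) hv)))

  Covers : ℕ → ℕ → Placement → Set
  Covers w h ps =
    ∀ (i : Fin w) (j : Fin h) → Any (λ p → ContainsCell (proj₂ p) (+ toℕ i) (+ toℕ j)) ps

  covers? : ∀ w h ps → Dec (Covers w h ps)
  covers? w h ps =
    Fin.all? λ i → Fin.all? λ j → Any.any? (λ p → containsCell? (proj₂ p) (+ toℕ i) (+ toℕ j)) ps

  covers : ℕ → ℕ → Placement → Bool
  covers w h ps = ⌊ covers? w h ps ⌋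

  search-complete-strong : ∀ {L w h} → StrongLayout H L → InFrame H L w h →
                           T (search w h λ _ → true)
  search-complete-strong strongL inFrame =
    Completeness.search-complete strongL inFrame _ λ _ _ → tt

  search-complete-dual : ∀ {L w h} → StrongLayout H L → InFrame H L w h → CoversFrame H L w h →
                         T (search w h (covers w h))
  search-complete-dual strongL inFrame cover =
    Completeness.search-complete strongL inFrame _ λ done placed → fromWitness λ i j →
      let v , hv , cell = cover i j in lose (∈-map⁺ _ (placed v hv)) cell

  SmallBox : ℕ → ℕ × ℕ → Set
  SmallBox A (w , h) = w ℕ.≤ h × w ℕ.* h ℕ.≤ A

  smallBox? : ∀ A b → Dec (SmallBox A b)
  smallBox? A (w , h) = w ℕ.≤? h ×-dec w ℕ.* h ℕ.≤? A

  boxes : ℕ → List (ℕ × ℕ)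
  boxes A = filter (smallBox? A) (cartesianProduct (upTo (suc A)) (upTo (suc A)))

  exhausted : (ℕ → ℕ → Placement → Bool) → ℕ → Bool
  exhausted leaf A = all (λ (w , h) → not (search w h (leaf w h))) (boxes A)

  -- The hypothesis is an equation because Agda checks `refl : exhausted leaf A ≡ true` much
  -- faster than `tt : T (exhausted leaf A)`.
  exhausted⇒¬search : ∀ {leaf A w h} → exhausted leaf A ≡ true → w ℕ.≤ h → w ℕ.* h ℕ.≤ A →
                     0 ℕ.< w → 0 ℕ.< h → ¬ T (search w h (leaf w h))
  exhausted⇒¬search {leaf} {A} {w} {h} exh w≤h wh≤A 0<w 0<h =
    subst T (Equivalence.to T-not-≡
              (All.lookup (All.all⁺ _ (boxes A) (Equivalence.from T-≡ exh)) wh∈boxes))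
    where
    w≤A = ℕ.≤-trans (ℕ.m≤m*n w h {{ℕ.>-nonZero 0<h}}) wh≤A
    h≤A = ℕ.≤-trans (ℕ.m≤n*m h w {{ℕ.>-nonZero 0<w}}) wh≤A
    wh∈boxes : (w , h) ∈ boxes A
    wh∈boxes = ∈-filter⁺ (smallBox? A)
                 (∈-cartesianProduct⁺ (∈-upTo⁺ (s≤s w≤A)) (∈-upTo⁺ (s≤s h≤A))) (w≤h , wh≤A)

  -- Only frames with w ≤ h are searched: a layout in a frame with w > h is transposed.
  noSmallFramedLayout : ∀ {leaf A} (Good : Layout n → ℕ → ℕ → Set) →
                        (∀ {L w h} → StrongLayout H L → InFrame H L w h → Good L w h →
                                     T (search w h (leaf w h))) →
                        (∀ {L w h} → Good L w h → Good (transpose ∘ L) h w) →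
                        exhausted leaf A ≡ true →
                        ∀ {L w h} → StrongLayout H L → InFrame H L w h → Good L w h →
                        w ℕ.* h ℕ.≤ A → 0 ℕ.< w → 0 ℕ.< h → ⊥
  noSmallFramedLayout {A = A} Good found transpose-good exh {w = w} {h}
                      strongL inFrame good wh≤A 0<w 0<h with ℕ.≤-total w h
  ... | inj₁ w≤h = exhausted⇒¬search exh w≤h wh≤A 0<w 0<h (found strongL inFrame good)
  ... | inj₂ h≤w =
    exhausted⇒¬search exh h≤w (subst (ℕ._≤ A) (ℕ.*-comm w h) wh≤A) 0<h 0<w
      (found (strongLayout-rigid transpose-rigid strongL) (inFrame-transpose H inFrame)
             (transpose-good good))

  noSmallStrongLayout : ∀ {A} v₀ → Vs H v₀ → exhausted (λ _ _ _ → true) A ≡ true →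
                        ∀ L → StrongLayout H L → ¬ FitsIn H L A
  noSmallStrongLayout v₀ hv₀ exh L strongL (B , x≤ , y≤ , inside , area) =
    noSmallFramedLayout (λ _ _ _ → ⊤) (λ s f _ → search-complete-strong s f) id exh
      strongL′ inFrame tt (area-bound B x≤ y≤ area) (proj₁ 0<w×0<h) (proj₂ 0<w×0<h)
    where
    strongL′ = strongLayout-rigid (translate-rigid (- x1 B) (- y1 B)) strongL
    inFrame = inFrame-translate H B x≤ y≤ inside
    0<w×0<h = frame-nonDeg (nonDeg-inside (proj₁ (proj₁ (proj₁ strongL′)) v₀ hv₀) (inFrame v₀ hv₀))

  noSmallRectDual : ∀ {A} → exhausted covers A ≡ true → ∀ L → RectDual H L → ¬ FitsIn H L A
  noSmallRectDual exh L (strongL , (R , (x< , y<) , inR , coverR) , _) (B , x≤ , y≤ , inB , area) =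
    noSmallFramedLayout (CoversFrame H) search-complete-dual (coversFrame-transpose H) exh
      strongL′ (inFrame-translate H R x≤R y≤R inR) (coversFrame-translate H R x≤R y≤R coverR)
      (ℕ.≤-trans (ℕ.*-mono-≤ (∣-∣-mono x≤R Bx≤ x≤B) (∣-∣-mono y≤R By≤ y≤B))
                 (area-bound B x≤ y≤ area))
      (proj₁ 0<w×0<h) (proj₂ 0<w×0<h)
    where
    strongL′ = strongLayout-rigid (translate-rigid (- x1 R) (- y1 R)) strongL
    x≤R = ℤ.<⇒≤ x<
    y≤R = ℤ.<⇒≤ y<
    R⊆B = partition-inside H (x< , y<) coverR inB
    Bx≤ = proj₁ R⊆B
    x≤B = proj₁ (proj₂ R⊆B)
    By≤ = proj₁ (proj₂ (proj₂ R⊆B))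
    y≤B = proj₂ (proj₂ (proj₂ R⊆B))
    0<w×0<h = frame-nonDeg (subst NonDeg (translate-to-frame R x≤R y≤R)
                                  (translate-nonDeg (- x1 R) (- y1 R) R (x< , y<)))

Adjacent : ∀ {n} → List (Fin n × Fin n) → Fin n → Fin n → Set
Adjacent es u v = (u , v) ∈ es ⊎ (v , u) ∈ es

adjacent? : ∀ {n} (es : List (Fin n × Fin n)) u v → Dec (Adjacent es u v)
adjacent? es u v = Any.any? (≡₂-dec (u , v)) es ⊎-dec Any.any? (≡₂-dec (v , u)) es
  where ≡₂-dec = Product.≡-dec _≟_ _≟_

loopless? : ∀ {n} (es : List (Fin n × Fin n)) → Dec (All (uncurry _≢_) es)
loopless? = All.all? λ (u , v) → ¬? (u ≟ v)

fromEdges : (n : ℕ) (es : List (Fin n × Fin n)) → All (uncurry _≢_) es → Graph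
fromEdges n es loopless = record
  { n = n ; adj = Adjacent es ; sym = Sum.swap ; irrefl = [ noLoop , noLoop ] }
  where
  noLoop : ∀ {v} → (v , v) ∈ es → ⊥
  noLoop v∈es = All.lookup loopless v∈es refl

module _ (G : Graph) (adj? : ∀ u v → Dec (adj G u v)) where

  delV-vertex? : ∀ {V′} → Decidable V′ → Decidable (Vs (delV G V′))
  delV-vertex? V′? v = ¬? (V′? v)

  delV-edge? : ∀ {V′} → Decidable V′ → ∀ u v → Dec (Es (delV G V′) u v)
  delV-edge? V′? u v = adj? u v ×-dec ¬? (V′? u) ×-dec ¬? (V′? v)

  delE-edge? : ∀ {E′} → (∀ u v → Dec (E′ u v)) → ∀ u v → Dec (Es (delE G E′) u v)
  delE-edge? E′? u v = adj? u v ×-dec ¬? (E′? u v ⊎-dec E′? v u)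

  delE-vertex? : ∀ {E′} → (∀ u v → Dec (E′ u v)) → Decidable (Vs (delE G E′))
  delE-vertex? E′? v = Fin.any? (delE-edge? E′? v)

-- Counterexamples

¬areaLE : ∀ {s n} {H K : SubG n} {a} (L : Layout n) → Renders s K L → FitsIn K L a →
          (∀ L′ → Renders s H L′ → ¬ FitsIn H L′ a) → ¬ AreaLE s H K
¬areaLE L rendersL fits noSmall le with le L rendersL _ fits
... | L′ , rendersL′ , fits′ = noSmall L′ rendersL′ fits′

[_,_]×[_,_] : ℕ → ℕ → ℕ → ℕ → Rect
[ a , b ]×[ c , d ] = rect (+ a) (+ b) (+ c) (+ d)

-- The path 0 – 1 – 2 – 3 drawn as four unit squares in a row; without its middle edge, the
-- rectangles of 1 and 2 must not touch.
module PathOfFour where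

  edges : List (Fin 4 × Fin 4)
  edges = (# 0 , # 1) ∷ (# 1 , # 2) ∷ (# 2 , # 3) ∷ []

  G : Graph
  G = fromEdges 4 edges (from-yes (loopless? edges))

  Middle : Fin 4 → Fin 4 → Set
  Middle u v = u ≡ # 1 × v ≡ # 2

  middle? : ∀ u v → Dec (Middle u v)
  middle? u v = u ≟ # 1 ×-dec v ≟ # 2

  H : SubG 4
  H = delE G Middle

  vs? : Decidable (Vs H)
  vs? = delE-vertex? G (adjacent? edges) middle?

  es? : ∀ u v → Dec (Es H u v)
  es? = delE-edge? G (adjacent? edges) middle?

  layoutG layoutH : Layout 4
  layoutG = lookup ([ 0 , 1 ]×[ 0 , 1 ] ∷ [ 1 , 2 ]×[ 0 , 1 ] ∷
                    [ 2 , 3 ]×[ 0 , 1 ] ∷ [ 3 , 4 ]×[ 0 , 1 ] ∷ [])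
  layoutH = lookup ([ 0 , 1 ]×[ 0 , 1 ] ∷ [ 1 , 2 ]×[ 0 , 1 ] ∷
                    [ 3 , 4 ]×[ 0 , 1 ] ∷ [ 4 , 5 ]×[ 0 , 1 ] ∷ [])

  module CheckG = Decide (full G) (λ _ → yes tt) (adjacent? edges) layoutG
  module CheckH = Decide H vs? es? layoutH

  ¬strong-edgeMonotone : ¬ EdgeMonotone strong
  ¬strong-edgeMonotone mono =
    ¬areaLE {strong} {H = H} layoutG strongG
      (fitsIn-frame (full G) 4 1 (from-yes (CheckG.inFrame? 4 1)) ℕ.≤-refl)
      (Search.noSmallStrongLayout H vs? es? (# 0) (from-yes (vs? (# 0))) refl)
      (mono G (layoutG , strongG) Middle (layoutH , from-yes CheckH.strongLayout?))
    where
    strongG = from-yes CheckG.strongLayout?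

module Butterfly where

  edges : List (Fin 5 × Fin 5)
  edges = (# 0 , # 1) ∷ (# 0 , # 2) ∷ (# 0 , # 3) ∷ (# 0 , # 4) ∷ (# 1 , # 2) ∷ (# 3 , # 4) ∷ []

  G : Graph
  G = fromEdges 5 edges (from-yes (loopless? edges))

  Spoke : Fin 5 → Fin 5 → Set
  Spoke u v = u ≡ # 0 × v ≡ # 1

  spoke? : ∀ u v → Dec (Spoke u v)
  spoke? u v = u ≟ # 0 ×-dec v ≟ # 1

  H : SubG 5
  H = delE G Spoke

  vs? : Decidable (Vs H)
  vs? = delE-vertex? G (adjacent? edges) spoke?

  es? : ∀ u v → Dec (Es H u v)
  es? = delE-edge? G (adjacent? edges) spoke?

  layoutG layoutH : Layout 5
  layoutG = lookup ([ 0 , 2 ]×[ 1 , 2 ] ∷ [ 0 , 1 ]×[ 0 , 1 ] ∷ [ 1 , 2 ]×[ 0 , 1 ] ∷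
                    [ 0 , 1 ]×[ 2 , 3 ] ∷ [ 1 , 2 ]×[ 2 , 3 ] ∷ [])
  layoutH = lookup ([ 0 , 2 ]×[ 1 , 2 ] ∷ [ 0 , 2 ]×[ 3 , 4 ] ∷ [ 0 , 2 ]×[ 2 , 3 ] ∷
                    [ 0 , 1 ]×[ 0 , 1 ] ∷ [ 1 , 2 ]×[ 0 , 1 ] ∷ [])

  module CheckG = Decide (full G) (λ _ → yes tt) (adjacent? edges) layoutG
  module CheckH = Decide H vs? es? layoutH

  ¬dual-edgeMonotone : ¬ EdgeMonotone dual
  ¬dual-edgeMonotone mono =
    ¬areaLE {dual} {H = H} layoutG dualG
      (fitsIn-frame (full G) 2 3 (from-yes (CheckG.inFrame? 2 3)) ℕ.≤-refl)
      (Search.noSmallRectDual H vs? es? refl)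
      (mono G (layoutG , dualG) Spoke
            (layoutH , CheckH.rectDual (from-yes (CheckH.dualOfFrame? 2 4))))
    where
    dualG = CheckG.rectDual (from-yes (CheckG.dualOfFrame? 2 3))

module EightVertices where

  edges : List (Fin 8 × Fin 8)
  edges = (# 0 , # 1) ∷ (# 0 , # 3) ∷ (# 1 , # 2) ∷ (# 1 , # 3) ∷ (# 2 , # 3) ∷
          (# 2 , # 5) ∷ (# 2 , # 7) ∷ (# 3 , # 4) ∷ (# 3 , # 5) ∷ (# 4 , # 5) ∷
          (# 4 , # 6) ∷ (# 5 , # 6) ∷ (# 5 , # 7) ∷ []

  G : Graph
  G = fromEdges 8 edges (from-yes (loopless? edges))

  Four : Fin 8 → Set
  Four v = v ≡ # 4

  H : SubG 8
  H = delV G Four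

  vs? : Decidable (Vs H)
  vs? = delV-vertex? G (adjacent? edges) (_≟ # 4)

  es? : ∀ u v → Dec (Es H u v)
  es? = delV-edge? G (adjacent? edges) (_≟ # 4)

  -- Vertex 4 is not in H; its rectangle is kept away from the others because the four-corner
  -- condition of `Decide.DualOfFrame` ranges over all labels.
  layoutG layoutH : Layout 8
  layoutG = lookup ([ 0 , 1 ]×[ 0 , 1 ] ∷ [ 1 , 2 ]×[ 0 , 1 ] ∷ [ 2 , 3 ]×[ 0 , 3 ] ∷
                    [ 0 , 2 ]×[ 1 , 2 ] ∷ [ 0 , 1 ]×[ 2 , 3 ] ∷ [ 1 , 2 ]×[ 2 , 4 ] ∷
                    [ 0 , 1 ]×[ 3 , 4 ] ∷ [ 2 , 3 ]×[ 3 , 4 ] ∷ [])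
  layoutH = lookup ([ 0 , 1 ]×[ 0 , 1 ] ∷ [ 0 , 1 ]×[ 1 , 2 ] ∷ [ 0 , 2 ]×[ 2 , 3 ] ∷
                    [ 1 , 2 ]×[ 0 , 2 ] ∷ [ 10 , 11 ]×[ 10 , 11 ] ∷ [ 2 , 3 ]×[ 0 , 4 ] ∷
                    [ 3 , 4 ]×[ 0 , 4 ] ∷ [ 0 , 2 ]×[ 3 , 4 ] ∷ [])

  module CheckG = Decide (full G) (λ _ → yes tt) (adjacent? edges) layoutG
  module CheckH = Decide H vs? es? layoutH

  ¬dual-vertexMonotone : ¬ VertexMonotone dual
  ¬dual-vertexMonotone mono =
    ¬areaLE {dual} {H = H} layoutG dualG
      (fitsIn-frame (full G) 3 4 (from-yes (CheckG.inFrame? 3 4)) ℕ.≤-refl)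
      (Search.noSmallRectDual H vs? es? refl)
      (mono G (layoutG , dualG) Four
            (layoutH , CheckH.rectDual (from-yes (CheckH.dualOfFrame? 4 4))))
    where
    dualG = CheckG.rectDual (from-yes (CheckG.dualOfFrame? 3 4))

theorem11 : (VertexMonotone weak × EdgeMonotone weak) ×
            (VertexMonotone strong × ¬ EdgeMonotone strong) ×
            (¬ VertexMonotone dual × ¬ EdgeMonotone dual)
theorem11 = (weak-vertexMonotone , weak-edgeMonotone) ,
            (strong-vertexMonotone , PathOfFour.¬strong-edgeMonotone) ,
            (EightVertices.¬dual-vertexMonotone , Butterfly.¬dual-edgeMonotone)
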